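{- Let $k\ge 3$. Let $\mathcal S$ be a set of $2$-$(u,k,1)$-designs (for various $u$), let $\bar{\mathcal S}$ be the set of all integers $u$ such that $\mathcal S$ contains a $2$-$(u,k,1)$-design, and let $w\in\bar{\mathcal S}$. Assume that whenever $x,y$ are integers with $x>x_0(k)$, $y>kx$, $x-1\equiv y-1\equiv 0\pmod{k-1}$, $x(x-1)\equiv y(y-1)\equiv 0\pmod{k(k-1)}$, and $y-x>n(k)$, we have $x+w(y-x)\in\bar{\mathcal S}$. Then $\bar{\mathcal S}$ contains every sufficiently large integer $u$ satisfying $u-1\equiv 0\pmod{k-1}$ and $u(u-1)\equiv 0\pmod{k(k-1)}$.
   Context: A $2$-$(v,k,1)$-design consists of a set of $v$ points together with a collection of $k$-element subsets (blocks) such that any two distinct points lie in exactly one block. A subdesign on $x$ points is a subset $X$ of $x$ points such that any two points of $X$ lie in a block contained in $X$. Fix an integer $x_0(k)>k$ such that whenever $x>x_0(k)$, $y>kx$, $x-1\equiv y-1\equiv 0\pmod{k-1}$ and $x(x-1)\equiv y(y-1)\equiv0\pmod{k(k-1)}$, there is a $2$-$(y,k,1)$-design having an $x$-point subdesign (such an integer exists by a theorem of Dukes, Lamken and Ling). Let $N(n)$ denote the maximum number of mutually orthogonal Latin squares of order $n$; fix an integer $n_0$ with $N(n)\ge\tfrac13 n^{1/91}$ for all $n>n_0$ (which exists by Chowla–Erdős–Straus), and set $n(k)=\max(n_0,(3k)^{91})$. -}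

module Defs where

open import Data.Nat using (ℕ; zero; suc; _+_; _*_; _∸_; _^_; _≤_; _<_; _⊔_)
open import Data.Nat.Divisibility using (_∣_)
open import Data.Fin using (Fin)
open import Data.Fin.Subset using (Subset; _∈_; _⊆_; ∣_∣)
open import Data.Product using (Σ; ∃; _×_; _,_)
open import Relation.Binary.PropositionalEquality using (_≡_; _≢_)
open import Function.Definitions using (Injective)

record Design (v k : ℕ) : Set where
  field
    b      : ℕ
    block  : Fin b → Subset v
    size   : ∀ i → ∣ block i ∣ ≡ k
    cover  : ∀ (p q : Fin v) → p ≢ q → ∃ λ i → p ∈ block i × q ∈ block i
    unique : ∀ (p q : Fin v) → p ≢ q → ∀ i j →
               p ∈ block i → q ∈ block i → p ∈ block j → q ∈ block j → i ≡ j
open Design public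

IsSubdesign : ∀ {v k} → Design v k → Subset v → Set
IsSubdesign D X = ∀ (p q : Fin _) → p ∈ X → q ∈ X → p ≢ q →
  ∃ λ i → p ∈ block D i × q ∈ block D i × block D i ⊆ X

record LatinSquare (n : ℕ) : Set where
  field
    cell   : Fin n → Fin n → Fin n
    rowInj : ∀ r → Injective _≡_ _≡_ (cell r)
    colInj : ∀ c → Injective _≡_ _≡_ (λ r → cell r c)
open LatinSquare public

Orthogonal : ∀ {n} → LatinSquare n → LatinSquare n → Set
Orthogonal {n} L M =
  ∀ (r c r′ c′ : Fin n) → cell L r c ≡ cell L r′ c′ → cell M r c ≡ cell M r′ c′ →
    (r ≡ r′) × (c ≡ c′)

HasMOLS : ℕ → ℕ → Set
HasMOLS m n = Σ (Fin m → LatinSquare n) λ L → ∀ i j → i ≢ j → Orthogonal (L i) (L j)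

Admissible : ℕ → ℕ → Set
Admissible k u = ((k ∸ 1) ∣ (u ∸ 1)) × ((k * (k ∸ 1)) ∣ (u * (u ∸ 1)))

-- the defining property of x₀(k) (Dukes–Lamken–Ling)
DLLBound : ℕ → ℕ → Set
DLLBound k x₀ = (k < x₀) × (∀ x y → x₀ < x → k * x < y → Admissible k x → Admissible k y →
  Σ (Design y k) λ D → ∃ λ X → IsSubdesign D X × ∣ X ∣ ≡ x)

-- the defining property of n₀ (Chowla–Erdős–Straus): N(n) ≥ n^{1/91}/3 for n > n₀,
-- i.e. there are m MOLS of order n with (3m)^91 ≥ n.
CESBound : ℕ → Set
CESBound n₀ = ∀ n → n₀ < n → ∃ λ m → n ≤ (3 * m) ^ 91 × HasMOLS m n

nOf : ℕ → ℕ → ℕ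
nOf n₀ k = n₀ ⊔ ((3 * k) ^ 91)

InBar : ∀ {k} → ((u : ℕ) → Design u k → Set) → ℕ → Set
InBar {k} S u = Σ (Design u k) λ D → S u D

-- Set K = k(k-1). Admissibility
-- of v + 1 depends only on v modulo K. Hence for admissible x > x₀ and any large enough q,
-- y = x + Kq is admissible and far above x, and the hypothesis puts x + wKq into S̄.
-- For w = 0 this is x itself; for w > 0 write u = x + wKq by dividing u - x₀ - 1 by wK,
-- where the remainder keeps x ≤ x₀ + wK, so q is large once u is.
module Submission where

open import Defs
open import Data.Nat using (ℕ; zero; suc; _+_; _*_; _∸_; _≤_; _<_; s≤s; NonZero)
open import Data.Nat.Properties
open import Data.Nat.Divisibility using (_∣_; ∣-trans; ∣m∣n⇒∣m+n; ∣m+n∣m⇒∣n; m∣m*n; n∣m*n)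
open import Data.Nat.DivMod using (_/_; _%_; m≡m%n+[m/n]*n; m%n<n; m*n/n≡m; /-monoˡ-≤)
open import Data.Nat.Tactic.RingSolver using (solve-∀)
open import Data.Product using (∃; _,_)
open import Relation.Binary.PropositionalEquality

private
  square-shift : ∀ a d → (suc a + d) * (a + d) ≡ suc a * a + d * (suc a + a + d)
  square-shift = solve-∀

module _ (k : ℕ) {x d : ℕ} (K∣d : k * (k ∸ 1) ∣ d) where

  private
    k∸1∣d : k ∸ 1 ∣ d
    k∸1∣d = ∣-trans (n∣m*n k) K∣d

    K∣d*e : ∀ e → k * (k ∸ 1) ∣ d * e
    K∣d*e e = ∣-trans K∣d (m∣m*n e)

  admissible-+-multiple : Admissible k (suc x) → Admissible k (suc x + d)
  admissible-+-multiple (k∸1∣x , K∣x*[x∸1]) =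
    ∣m∣n⇒∣m+n k∸1∣x k∸1∣d ,
    subst (k * (k ∸ 1) ∣_) (sym (square-shift x d)) (∣m∣n⇒∣m+n K∣x*[x∸1] (K∣d*e _))

  admissible-+-multiple⁻¹ : Admissible k (suc x + d) → Admissible k (suc x)
  admissible-+-multiple⁻¹ (k∸1∣x+d , K∣[x+d]*[x+d∸1]) =
    ∣m+n∣m⇒∣n (subst (k ∸ 1 ∣_) (+-comm x d) k∸1∣x+d) k∸1∣d ,
    ∣m+n∣m⇒∣n (subst (k * (k ∸ 1) ∣_) (trans (square-shift x d) (+-comm (suc x * x) _))
                     K∣[x+d]*[x+d∸1])
              (K∣d*e _)

module _ {A u : ℕ} (B M : ℕ) .{{_ : NonZero M}} (le : A + B * M ≤ u) where

  offset-divMod : u ≡ (A + (u ∸ A) % M) + (u ∸ A) / M * M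
  offset-divMod = begin
    u                                       ≡⟨ sym (m+[n∸m]≡n (≤-trans (m≤m+n A (B * M)) le)) ⟩
    A + (u ∸ A)                             ≡⟨ cong (A +_) (m≡m%n+[m/n]*n (u ∸ A) M) ⟩
    A + ((u ∸ A) % M + (u ∸ A) / M * M)     ≡⟨ sym (+-assoc A _ _) ⟩
    (A + (u ∸ A) % M) + (u ∸ A) / M * M     ∎
    where open ≡-Reasoning

  offset-quotient-≥ : B ≤ (u ∸ A) / M
  offset-quotient-≥ = subst (_≤ (u ∸ A) / M) (m*n/n≡m B M)
    (/-monoˡ-≤ M (subst (_≤ u ∸ A) (m+n∸m≡n A (B * M)) (∸-monoˡ-≤ A le)))

CompositionClosed : (k x₀ N w : ℕ) → ((u : ℕ) → Design u k → Set) → Set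
CompositionClosed k x₀ N w S =
  ∀ x y → x₀ < x → k * x < y → Admissible k x → Admissible k y →
    N < y ∸ x → InBar S (x + w * (y ∸ x))

module _ (k x₀ N w : ℕ) (S : (u : ℕ) → Design u k → Set) .{{_ : NonZero (k * (k ∸ 1))}}
         (closed : CompositionClosed k x₀ N w S) where

  inBar-+-w*K* : ∀ x q → x₀ < x → Admissible k x → k * x < q → N < q →
                 InBar S (x + w * (k * (k ∸ 1) * q))
  inBar-+-w*K* x@(suc _) q x₀<x adm-x kx<q N<q =
    subst (λ d → InBar S (x + w * d)) y∸x≡Kq
      (closed x y x₀<x kx<y adm-x (admissible-+-multiple k (m∣m*n q) adm-x) N<y∸x)
    where
      y = x + k * (k ∸ 1) * q
      y∸x≡Kq : y ∸ x ≡ k * (k ∸ 1) * q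
      y∸x≡Kq = m+n∸m≡n x _
      q≤y∸x : q ≤ y ∸ x
      q≤y∸x = subst (q ≤_) (sym y∸x≡Kq) (m≤n*m q (k * (k ∸ 1)))
      kx<y : k * x < y
      kx<y = <-≤-trans kx<q (≤-trans q≤y∸x (m∸n≤m y x))
      N<y∸x : N < y ∸ x
      N<y∸x = <-≤-trans N<q q≤y∸x

eventually-inBar : ∀ k x₀ N w (S : (u : ℕ) → Design u k → Set) .{{_ : NonZero (k * (k ∸ 1))}} →
                   CompositionClosed k x₀ N w S →
                   ∃ λ U → ∀ u → U ≤ u → Admissible k u → InBar S u
eventually-inBar k x₀ N zero S closed = suc x₀ , λ u x₀<u adm-u →
  subst (InBar S) (+-identityʳ u)
    (inBar-+-w*K* k x₀ N zero S closed u (suc (k * u + N)) x₀<u adm-u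
                  (s≤s (m≤m+n _ N)) (s≤s (m≤n+m N _)))
eventually-inBar k x₀ N (suc w′) S closed = A + B * M , λ u le adm-u →
  let q = (u ∸ A) / M
      x = A + (u ∸ A) % M
      u≡x+w*Kq : u ≡ x + suc w′ * (K * q)
      u≡x+w*Kq = trans (offset-divMod B M le)
                       (cong (x +_) (trans (*-comm q M) (*-assoc (suc w′) K q)))
      adm-x = admissible-+-multiple⁻¹ k (∣-trans (m∣m*n q) (n∣m*n (suc w′)))
                (subst (Admissible k) u≡x+w*Kq adm-u)
      x≤A+M = +-monoʳ-≤ A (<⇒≤ (m%n<n (u ∸ A) M))
      B≤q = offset-quotient-≥ B M le
      kx<q = <-≤-trans (s≤s (≤-trans (*-monoʳ-≤ k x≤A+M) (m≤m+n _ N))) B≤q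
      N<q = <-≤-trans (s≤s (m≤n+m N _)) B≤q
  in subst (InBar S) (sym u≡x+w*Kq)
       (inBar-+-w*K* k x₀ N (suc w′) S closed x q (s≤s (m≤m+n x₀ _)) adm-x kx<q N<q)
  where
    K = k * (k ∸ 1)
    A = suc x₀
    M = suc w′ * K
    instance
      M≢0 : NonZero M
      M≢0 = m*n≢0 (suc w′) K
    -- B exceeds both k x and N for every x ≤ A + M.
    B = suc (k * (A + M) + N)

proposition6p2 : ∀ (k : ℕ) → 3 ≤ k →
    ∀ (x₀ : ℕ) → DLLBound k x₀ →
    ∀ (n₀ : ℕ) → CESBound n₀ →
    ∀ (S : (u : ℕ) → Design u k → Set) (w : ℕ) → InBar S w →
    (∀ x y → x₀ < x → k * x < y → Admissible k x → Admissible k y →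
       nOf n₀ k < y ∸ x → InBar S (x + w * (y ∸ x))) →
    ∃ λ U → ∀ u → U ≤ u → Admissible k u → InBar S u
proposition6p2 k@(suc (suc (suc _))) (s≤s (s≤s (s≤s _))) x₀ _ n₀ _ S w _ closed =
  eventually-inBar k x₀ (nOf n₀ k) w S closed
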